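{- Let $n \geq 2$. Then there is a tree decomposition $(T,\beta)$ of $G_{n,n}^{+}$ of width $n+2$ such that (1) $|\beta(t) \cap V(G_{n,n})| \leq 1$ for every $t \in V(T)$, and (2) if $|\beta(t) \cap V(G_{n,n})| = 1$, then there is $v \in V(G_{n,n})$ with $\beta(t) = E(v) \cup \{v\}$, where $E(v) = \{(v,w) \mid vw \in E(G_{n,n})\}$; in this case $t$ is a leaf of $T$ and $\beta(s) \cap V(G_{n,n}) = \emptyset$ for the unique $s \in V(T)$ with $st \in E(T)$.
   Context: $G_{n,n}$ is the $(n\times n)$-grid: $V(G_{n,n})=[n]\times[n]$, with $(i,j)(i',j')$ an edge iff ($i=i'$ and $|j-j'|=1$) or ($j=j'$ and $|i-i'|=1$). $G_{n,n}^{+}$ is obtained by replacing each grid edge by a path of length 3: $V(G^+_{n,n})=V(G_{n,n})\cup\{(v,w)\mid vw\in E(G_{n,n})\}$ (ordered pairs, so each edge $vw$ yields two new vertices $(v,w)$ and $(w,v)$), and $E(G^+_{n,n})=\{v(v,w)\mid vw\in E(G_{n,n})\}\cup\{(v,w)(w,v)\mid vw\in E(G_{n,n})\}$. A tree decomposition of a graph $G$ is a pair $(T,\beta)$ with $T$ a tree and $\beta:V(T)\to 2^{V(G)}$ such that for every vertex $v$ the set $\{t\mid v\in\beta(t)\}$ is nonempty and induces a connected subtree, and every edge is contained in some $\beta(t)$; its width is $\max_t|\beta(t)|-1$. -}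

module Defs where

open import Data.Nat using (ℕ; _≤_; _+_; _≡ᵇ_; ∣_-_∣)
open import Data.Bool using (Bool; T; _∧_; _∨_)
open import Data.Fin using (Fin; toℕ)
open import Data.Product using (_×_; Σ; ∃; _,_)
open import Data.Sum using (_⊎_)
open import Data.List using (List; []; _∷_; length; mapMaybe; _∷ʳ_)
open import Data.Maybe using (Maybe; just; nothing)
open import Data.List.Relation.Unary.Unique.Propositional using (Unique)
open import Data.List.Relation.Unary.Linked using (Linked)
open import Data.List.Membership.Propositional using (_∈_)
open import Relation.Binary.PropositionalEquality using (_≡_)
open import Relation.Nullary using (¬_)
open import Data.Empty using (⊥)

data Walk {m : ℕ} (E : Fin m → Fin m → Set) (P : Fin m → Set)
          : Fin m → Fin m → Set where
  [] : ∀ {x} → P x → Walk E P x x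
  step : ∀ {x y z} → P x → E x y → Walk E P y z → Walk E P x z

record Trivial : Set where

IsCycle : {m : ℕ} → (Fin m → Fin m → Set) → List (Fin m) → Set
IsCycle E [] = ⊥
IsCycle E (x ∷ ys) = (2 ≤ length ys) × Unique (x ∷ ys) × Linked E ((x ∷ ys) ∷ʳ x)

record IsTree {m : ℕ} (E : Fin m → Fin m → Set) : Set where
  field
    nonempty   : 1 ≤ m
    symmetric  : ∀ x y → E x y → E y x
    irreflexive : ∀ x → ¬ E x x
    connected  : ∀ x y → Walk E (λ _ → Trivial) x y
    acyclic    : ∀ (xs : List (Fin m)) → ¬ IsCycle E xs

-- Tree decompositions of a graph with vertex type V and edge relation EG.
-- Bags are duplicate-free lists, so |β(t)| = length (β t).

record TreeDecomposition (V : Set) (EG : V → V → Set) : Set₁ where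
  field
    size  : ℕ
    ET    : Fin size → Fin size → Set
    isTree : IsTree ET
    β     : Fin size → List V
    bagUnique : ∀ t → Unique (β t)
    vertexCovered : ∀ v → ∃ λ t → v ∈ β t
    vertexConnected : ∀ v t t' → v ∈ β t → v ∈ β t' → Walk ET (λ s → v ∈ β s) t t'
    edgeCovered : ∀ v w → EG v w → ∃ λ t → (v ∈ β t) × (w ∈ β t)

HasWidth : ∀ {V EG} → TreeDecomposition V EG → ℕ → Set
HasWidth D k = (∀ t → length (β t) ≤ k + 1) × (∃ λ t → length (β t) ≡ k + 1)
  where open TreeDecomposition D

Cell : ℕ → Set
Cell n = Fin n × Fin n

gridAdj : ∀ {n} → Cell n → Cell n → Bool
gridAdj (i , j) (i' , j') =
  ((toℕ i ≡ᵇ toℕ i') ∧ (∣ toℕ j - toℕ j' ∣ ≡ᵇ 1)) ∨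
  ((toℕ j ≡ᵇ toℕ j') ∧ (∣ toℕ i - toℕ i' ∣ ≡ᵇ 1))

GridEdge : ∀ {n} → Cell n → Cell n → Set
GridEdge v w = T (gridAdj v w)

data V⁺ (n : ℕ) : Set where
  orig : Cell n → V⁺ n
  sub  : (v w : Cell n) → GridEdge v w → V⁺ n

data E⁺ {n : ℕ} : V⁺ n → V⁺ n → Set where
  e-end : ∀ v w (p : GridEdge v w) → E⁺ (orig v) (sub v w p)
  e-mid : ∀ v w (p : GridEdge v w) (q : GridEdge w v) → E⁺ (sub v w p) (sub w v q)

gridPart : ∀ {n} → List (V⁺ n) → List (Cell n)
gridPart = mapMaybe f
  where
  f : ∀ {n} → V⁺ n → Maybe (Cell n)
  f (orig v) = just v
  f (sub _ _ _) = nothing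

InStar : ∀ {n} → Cell n → V⁺ n → Set
InStar {n} v x = (x ≡ orig v) ⊎ (Σ (Cell n) λ w → Σ (GridEdge v w) λ p → x ≡ sub v w p)

IsLeaf : ∀ {m} → (Fin m → Fin m → Set) → Fin m → Set
IsLeaf ET t = ∃ λ s → ET s t × (∀ s' → ET s' t → s' ≡ s)

module Submission where

-- The tree is a caterpillar: a spine path on the positions 0 … 3n² - 1, and
-- for every cell v of row-major index i a leaf, attached at position 3i + 2,
-- whose bag is E(v) ∪ {v}.  Every half-edge (v,w) is assigned an interval of
-- spine positions that contains 3i + 2 and meets the interval of (w,v); the
-- spine bag at q holds the half-edges whose interval contains q.  Half-edges
-- are coloured (by column for steps down, by n, n + 1, n + 2 for steps right,
-- up, left) so that equal colours have disjoint intervals; hence spine bags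
-- have at most n + 3 elements, and the bag at position 3n has exactly n + 3.

open import Defs
open import Data.Nat using (ℕ; zero; suc; _≤_; _<_; _+_; _*_; _∸_; z≤n; s≤s; _≡ᵇ_; ∣_-_∣; _≟_; _<?_; _≤?_)
open import Data.Nat.Properties
  using (*-cancelˡ-<; *-distribˡ-+; *-identityʳ; *-monoʳ-≤; *-zeroʳ; +-assoc; +-cancelʳ-<; +-cancelʳ-≤; +-comm;
         +-identityʳ; +-monoʳ-≤; +-monoˡ-≤; +-suc; 0≢1+n; 1+n≢n; <-cmp; <-irrefl; <-trans; <⇒≱; m∸n+n≡m;
         m∸n≤m; m≤m+n; m≤n+m; m≤n⇒m<n∨m≡n; n≤1+n; n≮0; suc-injective; ∸-monoʳ-<; ≡ᵇ⇒≡; ≡⇒≡ᵇ; ≤-<-trans;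
         ≤-antisym; ≤-pred; ≤-refl; ≤-reflexive; ≤-trans; ≤∧≢⇒<; ≮⇒≥; module ≤-Reasoning)
open import Data.Nat.Tactic.RingSolver using (solve-∀)
open import Data.Bool using (T)
open import Data.Bool.Properties using (T?; T-∨; T-∧; T-irrelevant)
open import Data.Fin using (Fin; toℕ; fromℕ<; _↑ˡ_; _↑ʳ_; splitAt; combine; remQuot)
open import Data.Fin.Properties
  using (toℕ<n; toℕ-injective; toℕ-↑ˡ; toℕ-↑ʳ; toℕ-fromℕ<; splitAt-↑ˡ; splitAt-↑ʳ; splitAt⁻¹-↑ˡ; splitAt⁻¹-↑ʳ;
         combine-remQuot; remQuot-combine; toℕ-combine)
  renaming (_≟_ to _≟ᶠ_)
open import Data.Product using (_×_; Σ; ∃; _,_; proj₁; proj₂)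
open import Data.Product.Properties using (≡-dec)
open import Data.Sum using (_⊎_; inj₁; inj₂; [_,_]′)
open import Data.Maybe using (Maybe; just; nothing)
import Data.Maybe.Relation.Unary.Any as MaybeAny
open import Data.List
  using (List; []; _∷_; length; _∷ʳ_; map; filter; deduplicate; mapMaybe; cartesianProduct; allFin; upTo; _++_)
open import Data.List.Properties using (length-removeAt′; length-++; length-map; length-upTo)
open import Data.List.Relation.Unary.All as All using (All; []; _∷_)
open import Data.List.Relation.Unary.AllPairs as AllPairs using ([]; _∷_)
open import Data.List.Relation.Unary.Any as Any using (here; there; _─_)
import Data.List.Relation.Unary.Any.Properties as Any
open import Data.List.Relation.Unary.Linked using (Linked; [-]; _∷_)
open import Data.List.Relation.Unary.Unique.Propositional using (Unique)
import Data.List.Relation.Unary.Unique.Propositional.Properties as Unique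
open import Data.List.Relation.Unary.Unique.DecPropositional.Properties using (deduplicate-!)
open import Data.List.Membership.Propositional using (_∈_)
open import Data.List.Membership.Propositional.Properties
  using (∈-filter⁺; ∈-filter⁻; ∈-deduplicate⁺; ∈-map⁺; ∈-++⁺ˡ; ∈-++⁺ʳ; ∈-cartesianProduct⁺; ∈-allFin;
         ∈-upTo⁺; ∈-upTo⁻)
open import Relation.Binary.PropositionalEquality
open import Relation.Binary.Definitions using (DecidableEquality; tri<; tri≈; tri>)
open import Relation.Nullary using (¬_; yes; no)
open import Relation.Nullary.Decidable using (_×-dec_; map′)
open import Relation.Unary using (Decidable)
open import Data.Empty using (⊥; ⊥-elim)
open import Function using (_∘_)
open import Function.Bundles using (Equivalence; _⇔_; mk⇔)

∈-─ : ∀ {A : Set} {y z : A} {xs} (p : y ∈ xs) → z ∈ xs → z ≢ y → z ∈ (xs ─ p)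
∈-─ (here refl) (here refl) z≢y = ⊥-elim (z≢y refl)
∈-─ (here refl) (there z∈xs) _ = z∈xs
∈-─ (there p) (here refl) _ = here refl
∈-─ (there p) (there z∈xs) z≢y = there (∈-─ p z∈xs z≢y)

injection-length : ∀ {A B : Set} (f : A → B) (xs : List A) (ys : List B) → Unique xs →
  (∀ {x} → x ∈ xs → f x ∈ ys) →
  (∀ {x x'} → x ∈ xs → x' ∈ xs → f x ≡ f x' → x ≡ x') →
  length xs ≤ length ys
injection-length f [] ys _ _ _ = z≤n
injection-length f (x ∷ xs) ys (x∉xs ∷ xs-unique) into injective =
  subst (suc (length xs) ≤_) (sym (length-removeAt′ ys (Any.index fx∈ys)))
    (s≤s (injection-length f xs (ys ─ fx∈ys) xs-unique into-rest (λ m m' → injective (there m) (there m'))))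
  where
  fx∈ys : f x ∈ ys
  fx∈ys = into (here refl)
  into-rest : ∀ {x'} → x' ∈ xs → f x' ∈ (ys ─ fx∈ys)
  into-rest m = ∈-─ fx∈ys (into (there m))
    (λ e → All.lookup x∉xs m (sym (injective (there m) (here refl) e)))

module Listing {A : Set} (_≟ᴬ_ : DecidableEquality A) (enum : List A) (complete : ∀ x → x ∈ enum) where

  listing : {P : A → Set} → Decidable P → List A
  listing P? = filter P? (deduplicate _≟ᴬ_ enum)

  listing-unique : ∀ {P : A → Set} (P? : Decidable P) → Unique (listing P?)
  listing-unique P? = Unique.filter⁺ P? (deduplicate-! _≟ᴬ_ enum)

  listing⁺ : ∀ {P : A → Set} (P? : Decidable P) {x} → P x → x ∈ listing P?
  listing⁺ P? px = ∈-filter⁺ P? (∈-deduplicate⁺ _≟ᴬ_ (complete _)) px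

  listing⁻ : ∀ {P : A → Set} (P? : Decidable P) {x} → x ∈ listing P? → P x
  listing⁻ P? x∈ = proj₂ (∈-filter⁻ P? {xs = deduplicate _≟ᴬ_ enum} x∈)

module _ {m : ℕ} {E : Fin m → Fin m → Set} {P : Fin m → Set} where

  _++ʷ_ : ∀ {x y z} → Walk E P x y → Walk E P y z → Walk E P x z
  [] _ ++ʷ w' = w'
  step px e w ++ʷ w' = step px e (w ++ʷ w')

  snocʷ : ∀ {x y z} → Walk E P x y → E y z → P z → Walk E P x z
  snocʷ ([] px) e pz = step px e ([] pz)
  snocʷ (step px e w) e' pz = step px e (snocʷ w e' pz)

  reverseʷ : (∀ a b → E a b → E b a) → ∀ {x y} → Walk E P x y → Walk E P y x
  reverseʷ sym-E ([] px) = [] px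
  reverseʷ sym-E (step px e w) = snocʷ (reverseʷ sym-E w) (sym-E _ _ e) px

-- Any function pointing every non-zero node of Fin m to a node of smaller
-- index defines a tree: join each node to its parent.  The root is index 0.
module ParentPointers {m : ℕ} (parent : Fin m → Fin m)
                      (parent-< : ∀ x → 0 < toℕ x → toℕ (parent x) < toℕ x) where

  ChildOf : Fin m → Fin m → Set
  ChildOf x y = 0 < toℕ y × parent y ≡ x

  Edge : Fin m → Fin m → Set
  Edge x y = ChildOf x y ⊎ ChildOf y x

  Edge-sym : ∀ x y → Edge x y → Edge y x
  Edge-sym _ _ (inj₁ c) = inj₂ c
  Edge-sym _ _ (inj₂ c) = inj₁ c

  Edge-irrefl : ∀ x → ¬ Edge x x
  Edge-irrefl x (inj₁ (pos , eq)) = <-irrefl (cong toℕ eq) (parent-< x pos)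
  Edge-irrefl x (inj₂ (pos , eq)) = <-irrefl (cong toℕ eq) (parent-< x pos)

  toRoot : ∀ k x → toℕ x ≤ k → Σ (Fin m) λ r → toℕ r ≡ 0 × Walk Edge (λ _ → Trivial) x r
  toRoot _ Fin.zero _ = Fin.zero , refl , [] _
  toRoot (suc k) x@(Fin.suc y) (s≤s y≤k)
    with toRoot k (parent x) (≤-pred (≤-trans (parent-< x (s≤s z≤n)) (s≤s y≤k)))
  ... | r , r≡0 , w = r , r≡0 , step _ (inj₂ (s≤s z≤n , refl)) w

  connected : ∀ x y → Walk Edge (λ _ → Trivial) x y
  connected x y with toRoot (toℕ x) x ≤-refl | toRoot (toℕ y) y ≤-refl
  ... | r , r≡0 , w | r' , r'≡0 , w' with toℕ-injective {i = r} {j = r'} (trans r≡0 (sym r'≡0))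
  ... | refl = w ++ʷ reverseʷ Edge-sym w'

  -- On a simple path, a step down to a child can never be followed by a
  -- step back up (that would revisit the parent), so after a ↦ b the path
  -- stays strictly below a: a later node x lies deeper than a, or x is the
  -- immediate return to a, or x repeats a node of the path.
  downward : ∀ a b zs x → Unique (a ∷ b ∷ zs) → Linked Edge ((a ∷ b ∷ zs) ∷ʳ x) → ChildOf a b →
             toℕ a < toℕ x ⊎ (zs ≡ [] × x ≡ a) ⊎ x ∈ b ∷ zs
  downward a b [] x _ (_ ∷ inj₁ (x>0 , refl) ∷ [-]) (b>0 , refl) =
    inj₁ (<-trans (parent-< b b>0) (parent-< x x>0))
  downward a b [] x _ (_ ∷ inj₂ (_ , refl) ∷ [-]) (_ , refl) = inj₂ (inj₁ (refl , refl))
  downward a b (c ∷ zs) x (_ ∷ unique) (_ ∷ inj₁ c-child ∷ links) (b>0 , refl)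
    with downward b c zs x unique (inj₁ c-child ∷ links) c-child
  ... | inj₁ b<x = inj₁ (<-trans (parent-< b b>0) b<x)
  ... | inj₂ (inj₁ (_ , refl)) = inj₂ (inj₂ (here refl))
  ... | inj₂ (inj₂ x∈c∷zs) = inj₂ (inj₂ (there x∈c∷zs))
  downward a b (c ∷ zs) x ((_ ∷ a∉c∷zs) ∷ _) (_ ∷ inj₂ (_ , refl) ∷ _) (_ , refl) =
    ⊥-elim (All.lookup a∉c∷zs (here refl) refl)

  rotate : ∀ x y ys → IsCycle Edge (x ∷ y ∷ ys) → IsCycle Edge (y ∷ ys ∷ʳ x)
  rotate x y [] (s≤s () , _)
  rotate x y (z ∷ zs) (_ , x∉ys ∷ unique , e ∷ links) =
    s≤s (subst (1 ≤_) (sym (length-++ zs)) (m≤n+m 1 (length zs)))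
    , Unique.++⁺ unique ([] ∷ []) (λ { (x∈ys , here refl) → All.lookup x∉ys x∈ys refl })
    , snoc-link (y ∷ z ∷ zs) links e
    where
    snoc-link : ∀ zs {u v} → Linked Edge (zs ∷ʳ u) → Edge u v → Linked Edge (zs ∷ʳ u ∷ʳ v)
    snoc-link [] [-] e = e ∷ [-]
    snoc-link (_ ∷ []) (e' ∷ [-]) e = e' ∷ e ∷ [-]
    snoc-link (_ ∷ z ∷ zs) (e' ∷ links) e = e' ∷ snoc-link (z ∷ zs) links e

  -- By induction on the index of the starting node: if the cycle leaves x
  -- upwards, rotate it to start at the smaller parent; if it leaves x
  -- downwards, `downward` forbids it from ever returning to x.
  acyclicFrom : ∀ k x ys → toℕ x ≤ k → ¬ IsCycle Edge (x ∷ ys)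
  acyclicFrom k x [] _ (() , _)
  acyclicFrom k x (y ∷ []) _ (s≤s () , _)
  acyclicFrom k x (y ∷ z ∷ zs) _ (_ , unique , inj₁ y-child ∷ links)
    with downward x y (z ∷ zs) x unique (inj₁ y-child ∷ links) y-child
  ... | inj₁ x<x = <-irrefl refl x<x
  ... | inj₂ (inj₁ (() , _))
  ... | inj₂ (inj₂ x∈ys) = All.lookup (AllPairs.head unique) x∈ys refl
  acyclicFrom zero x (y ∷ z ∷ zs) x≤0 (_ , _ , inj₂ (x>0 , _) ∷ _) = n≮0 (≤-trans x>0 x≤0)
  acyclicFrom (suc k) x (y ∷ z ∷ zs) x≤k cycle@(_ , _ , inj₂ (x>0 , refl) ∷ _) =
    acyclicFrom k y (z ∷ zs ∷ʳ x) (≤-pred (≤-trans (parent-< x x>0) x≤k)) (rotate x y (z ∷ zs) cycle)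

  isTree : 1 ≤ m → IsTree Edge
  isTree m≥1 = record
    { nonempty = m≥1 ; symmetric = Edge-sym ; irreflexive = Edge-irrefl ; connected = connected
    ; acyclic = λ { [] () ; (x ∷ ys) → acyclicFrom (toℕ x) x ys ≤-refl } }

distance-one⁻ : ∀ a b → T (∣ a - b ∣ ≡ᵇ 1) → a ≡ suc b ⊎ b ≡ suc a
distance-one⁻ zero (suc zero) _ = inj₂ refl
distance-one⁻ (suc zero) zero _ = inj₁ refl
distance-one⁻ (suc a) (suc b) d with distance-one⁻ a b d
... | inj₁ a≡1+b = inj₁ (cong suc a≡1+b)
... | inj₂ b≡1+a = inj₂ (cong suc b≡1+a)

distance-one⁺ : ∀ {a b} → a ≡ suc b ⊎ b ≡ suc a → T (∣ a - b ∣ ≡ᵇ 1)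
distance-one⁺ {b = zero} (inj₁ refl) = _
distance-one⁺ {b = suc b} (inj₁ refl) = distance-one⁺ {b = b} (inj₁ refl)
distance-one⁺ {a = zero} (inj₂ refl) = _
distance-one⁺ {a = suc a} (inj₂ refl) = distance-one⁺ {a = a} (inj₂ refl)

2+n≢n : ∀ {a} → suc (suc a) ≢ a
2+n≢n {suc a} e = 2+n≢n (suc-injective e)

triple-≤ : ∀ a b → 3 * a ≤ 3 * b + 2 → a ≤ b
triple-≤ a b h = ≤-pred (*-cancelˡ-< 3 a (suc b) (≤-trans (s≤s h) (≤-reflexive (next b))))
  where
  next : ∀ b → suc (3 * b + 2) ≡ 3 * suc b
  next = solve-∀

thirds : ∀ k a b → 3 * a + k ≤ 3 * b + (k + 2) → a ≤ b
thirds k a b h = triple-≤ a b (+-cancelʳ-≤ k _ _ (≤-trans h (≤-reflexive shift)))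
  where
  shift : 3 * b + (k + 2) ≡ 3 * b + 2 + k
  shift = trans (cong (3 * b +_) (+-comm k 2)) (sym (+-assoc (3 * b) 2 k))

triple-< : ∀ a b → 3 * a + 2 ≤ 3 * b → a < b
triple-< a b h = triple-≤ (suc a) b
  (≤-trans (≤-reflexive (next a)) (≤-trans (+-monoˡ-≤ 1 h) (+-monoʳ-≤ (3 * b) (s≤s z≤n))))
  where
  next : ∀ a → 3 * suc a ≡ 3 * a + 2 + 1
  next = solve-∀

triple-<⁺ : ∀ {a b} → a < b → 3 * a + 2 ≤ 3 * b
triple-<⁺ {a} a<b = ≤-trans (n≤1+n _) (≤-trans (≤-reflexive (next a)) (*-monoʳ-≤ 3 a<b))
  where
  next : ∀ a → suc (3 * a + 2) ≡ 3 * suc a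
  next = solve-∀

module Grid (n : ℕ) where

  row col index : Cell n → ℕ
  row v = toℕ (proj₁ v)
  col v = toℕ (proj₂ v)
  index v = n * row v + col v

  cell-≡ : ∀ {v w : Cell n} → row v ≡ row w → col v ≡ col w → v ≡ w
  cell-≡ r c = cong₂ _,_ (toℕ-injective r) (toℕ-injective c)

  index-injective : ∀ v w → index v ≡ index w → v ≡ w
  index-injective (i , j) (i' , j') eq = begin
    (i , j)                   ≡⟨ sym (remQuot-combine i j) ⟩
    remQuot n (combine i j)   ≡⟨ cong (remQuot n) (toℕ-injective same-position) ⟩
    remQuot n (combine i' j') ≡⟨ remQuot-combine i' j' ⟩
    (i' , j')                 ∎
    where
    open ≡-Reasoning
    same-position : toℕ (combine i j) ≡ toℕ (combine i' j')
    same-position = trans (toℕ-combine i j) (trans eq (sym (toℕ-combine i' j')))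

  index-< : ∀ v → index v < n * n
  index-< (i , j) = subst (_< n * n) (toℕ-combine i j) (toℕ<n (combine i j))

  col-< : ∀ v → col v < n
  col-< v = toℕ<n (proj₂ v)

  data Direction : Set where
    down up right left : Direction

  data Step : Direction → Cell n → Cell n → Set where
    down  : ∀ {v w} → row w ≡ suc (row v) → col w ≡ col v → Step down v w
    up    : ∀ {v w} → row v ≡ suc (row w) → col w ≡ col v → Step up v w
    right : ∀ {v w} → row w ≡ row v → col w ≡ suc (col v) → Step right v w
    left  : ∀ {v w} → row w ≡ row v → col v ≡ suc (col w) → Step left v w

  classify : ∀ v w → GridEdge v w → Σ Direction λ d → Step d v w
  classify v w p with Equivalence.to T-∨ p
  ... | inj₁ same-row with Equivalence.to T-∧ same-row
  ...   | r , d with distance-one⁻ (col v) (col w) d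
  ...     | inj₁ c = left , left (sym (≡ᵇ⇒≡ _ _ r)) c
  ...     | inj₂ c = right , right (sym (≡ᵇ⇒≡ _ _ r)) c
  classify v w p | inj₂ same-col with Equivalence.to T-∧ same-col
  ...   | c , d with distance-one⁻ (row v) (row w) d
  ...     | inj₁ r = up , up r (sym (≡ᵇ⇒≡ _ _ c))
  ...     | inj₂ r = down , down r (sym (≡ᵇ⇒≡ _ _ c))

  horizontal : ∀ {v w} → row v ≡ row w → col v ≡ suc (col w) ⊎ col w ≡ suc (col v) → GridEdge v w
  horizontal r c = Equivalence.from T-∨ (inj₁ (Equivalence.from T-∧ (≡⇒≡ᵇ _ _ r , distance-one⁺ c)))

  vertical : ∀ {v w} → col v ≡ col w → row v ≡ suc (row w) ⊎ row w ≡ suc (row v) → GridEdge v w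
  vertical c r = Equivalence.from T-∨ (inj₂ (Equivalence.from T-∧ (≡⇒≡ᵇ _ _ c , distance-one⁺ r)))

  step-edge : ∀ {d v w} → Step d v w → GridEdge v w
  step-edge (down r c) = vertical (sym c) (inj₂ r)
  step-edge (up r c) = vertical (sym c) (inj₁ r)
  step-edge (right r c) = horizontal (sym r) (inj₂ c)
  step-edge (left r c) = horizontal (sym r) (inj₁ c)

  direction-unique : ∀ {d d' v w} → Step d v w → Step d' v w → d ≡ d'
  direction-unique (down _ _) (down _ _) = refl
  direction-unique (up _ _) (up _ _) = refl
  direction-unique (right _ _) (right _ _) = refl
  direction-unique (left _ _) (left _ _) = refl
  direction-unique (down r _) (up r' _) = ⊥-elim (2+n≢n (sym (trans r (cong suc r'))))
  direction-unique (up r' _) (down r _) = ⊥-elim (2+n≢n (sym (trans r (cong suc r'))))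
  direction-unique (down r _) (right r' _) = ⊥-elim (1+n≢n (trans (sym r) r'))
  direction-unique (right r' _) (down r _) = ⊥-elim (1+n≢n (trans (sym r) r'))
  direction-unique (down r _) (left r' _) = ⊥-elim (1+n≢n (trans (sym r) r'))
  direction-unique (left r' _) (down r _) = ⊥-elim (1+n≢n (trans (sym r) r'))
  direction-unique (up r _) (right r' _) = ⊥-elim (1+n≢n (trans (sym r) (sym r')))
  direction-unique (right r' _) (up r _) = ⊥-elim (1+n≢n (trans (sym r) (sym r')))
  direction-unique (up r _) (left r' _) = ⊥-elim (1+n≢n (trans (sym r) (sym r')))
  direction-unique (left r' _) (up r _) = ⊥-elim (1+n≢n (trans (sym r) (sym r')))
  direction-unique (right _ c) (left _ c') = ⊥-elim (2+n≢n (sym (trans c' (cong suc c))))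
  direction-unique (left _ c') (right _ c) = ⊥-elim (2+n≢n (sym (trans c' (cong suc c))))

  target-unique : ∀ {d v w w'} → Step d v w → Step d v w' → w ≡ w'
  target-unique (down r c) (down r' c') = cell-≡ (trans r (sym r')) (trans c (sym c'))
  target-unique (up r c) (up r' c') = cell-≡ (suc-injective (trans (sym r) r')) (trans c (sym c'))
  target-unique (right r c) (right r' c') = cell-≡ (trans r (sym r')) (trans c (sym c'))
  target-unique (left r c) (left r' c') = cell-≡ (trans r (sym r')) (suc-injective (trans (sym c) c'))

  opposite : Direction → Direction
  opposite down = up
  opposite up = down
  opposite right = left
  opposite left = right

  reverse-step : ∀ {d v w} → Step d v w → Step (opposite d) w v
  reverse-step (down r c) = up r (sym c)
  reverse-step (up r c) = down r (sym c)
  reverse-step (right r c) = left (sym r) c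
  reverse-step (left r c) = right (sym r) c

  index-down : ∀ {v w} → Step down v w → index w ≡ index v + n
  index-down {v} {w} (down r c) = begin
    n * row w + col w        ≡⟨ cong₂ (λ a b → n * a + b) r c ⟩
    n * suc (row v) + col v  ≡⟨ shift n (row v) (col v) ⟩
    n * row v + col v + n    ∎
    where
    open ≡-Reasoning
    shift : ∀ n a b → n * suc a + b ≡ n * a + b + n
    shift = solve-∀

  index-right : ∀ {v w} → Step right v w → index w ≡ suc (index v)
  index-right {v} {w} (right r c) = trans (cong₂ (λ a b → n * a + b) r c) (+-suc (n * row v) (col v))

module Schedule (n : ℕ) where
  open Grid n

  -- The cell of index i owns the positions 3i, 3i+1, 3i+2 and its leaf
  -- bag is attached at 3i+2.
  attach : Cell n → ℕ
  attach v = 3 * index v + 2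

  -- A step right into the last column is stretched by two positions, so
  -- that position 3n carries all n + 3 colours and the width is attained.
  rightEnd : Cell n → ℕ
  rightEnd v with 2 + col v ≟ n
  ... | yes _ = 3 * index v + 6
  ... | no _ = 3 * index v + 4

  rightEnd-cases : ∀ v → rightEnd v ≡ 3 * index v + 4 ⊎ (2 + col v ≡ n × rightEnd v ≡ 3 * index v + 6)
  rightEnd-cases v with 2 + col v ≟ n
  ... | yes last = inj₂ (last , refl)
  ... | no _ = inj₁ refl

  rightEnd-last : ∀ v → 2 + col v ≡ n → rightEnd v ≡ 3 * index v + 6
  rightEnd-last v last with 2 + col v ≟ n
  ... | yes _ = refl
  ... | no ¬last = ⊥-elim (¬last last)

  rightEnd-≥ : ∀ v → 3 * index v + 4 ≤ rightEnd v
  rightEnd-≥ v with rightEnd-cases v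
  ... | inj₁ e = ≤-reflexive (sym e)
  ... | inj₂ (_ , e) = ≤-trans (+-monoʳ-≤ (3 * index v) (s≤s (s≤s (s≤s (s≤s z≤n))))) (≤-reflexive (sym e))

  start end : Direction → Cell n → ℕ
  start down v = 3 * index v + 2
  start up v = 3 * index v
  start right v = 3 * index v + 2
  start left v = 3 * index v + 1
  end down v = 3 * (index v + n)
  end up v = 3 * index v + 2
  end right v = rightEnd v
  end left v = 3 * index v + 3

  Inside : Direction → Cell n → ℕ → Set
  Inside d v q = start d v ≤ q × q ≤ end d v

  colour : Direction → Cell n → ℕ
  colour down v = col v
  colour right _ = n
  colour up _ = suc n
  colour left _ = suc (suc n)

  colour-< : ∀ d v → colour d v < n + 3
  colour-< d v = ≤-trans (bound d) (≤-reflexive (+-comm 3 n))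
    where
    bound : ∀ d → colour d v < 3 + n
    bound down = ≤-trans (col-< v) (m≤n+m n 3)
    bound up = s≤s (s≤s (n≤1+n n))
    bound right = s≤s (≤-trans (n≤1+n n) (n≤1+n _))
    bound left = ≤-refl

  column-colour : ∀ v {k} → n ≤ k → col v ≢ k
  column-colour v n≤k refl = <⇒≱ (col-< v) n≤k

  Overlap : Direction → Cell n → Direction → Cell n → Set
  Overlap d v d' v' = start d v ≤ end d' v' × start d' v' ≤ end d v

  down-rows : ∀ v v' → col v ≡ col v' → start down v ≤ end down v' → row v ≤ row v'
  down-rows v v' same-col h = ≤-pred (*-cancelˡ-< n (row v) (suc (row v')) (+-cancelʳ-< (col v) _ _ below))
    where
    shift : ∀ n r c → n * r + c + n ≡ n * suc r + c
    shift = solve-∀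
    next-row : index v' + n ≡ n * suc (row v') + col v
    next-row = trans (shift n (row v') (col v')) (cong (n * suc (row v') +_) (sym same-col))
    below : n * row v + col v < n * suc (row v') + col v
    below = subst (index v <_) next-row (triple-< (index v) (index v' + n) h)

  -- Rightward intervals of different cells are disjoint: a stretched one
  -- reaches only the next cell, which lies in the last column and has no
  -- step right.
  right-disjoint : ∀ {v w v' w'} → Step right v w → Step right v' w' → index v < index v' →
                   ¬ start right v' ≤ end right v
  right-disjoint {v} {w} {v'} {w'} v→w v'→w' i<i' h with rightEnd-cases v
  ... | inj₁ e = <⇒≱ i<i' (thirds 2 (index v') (index v) (subst (start right v' ≤_) e h))
  ... | inj₂ (last , e)
    with m≤n⇒m<n∨m≡n (thirds 2 (index v') (suc (index v))
                        (≤-trans (subst (start right v' ≤_) e h) (stretch (index v))))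
    where
    stretch : ∀ i → 3 * i + 6 ≤ 3 * suc i + 4
    stretch i = ≤-trans (n≤1+n _) (≤-reflexive (next i))
      where
      next : ∀ i → suc (3 * i + 6) ≡ 3 * suc i + 4
      next = solve-∀
  ...   | inj₁ i'<1+i = <⇒≱ i<i' (≤-pred i'<1+i)
  ...   | inj₂ i'≡1+i with index-injective v' w (trans i'≡1+i (sym (index-right v→w)))
  ...     | refl with v→w | v'→w'
  ...       | right _ c | right _ c' = <-irrefl (trans (trans c' (cong suc c)) last) (col-< w')

  colour-direction : ∀ {d d'} v v' → colour d v ≡ colour d' v' → d ≡ d'
  colour-direction {down} {down} _ _ _ = refl
  colour-direction {up} {up} _ _ _ = refl
  colour-direction {right} {right} _ _ _ = refl
  colour-direction {left} {left} _ _ _ = refl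
  colour-direction {down} {right} v _ e = ⊥-elim (column-colour v ≤-refl e)
  colour-direction {down} {up} v _ e = ⊥-elim (column-colour v (n≤1+n n) e)
  colour-direction {down} {left} v _ e = ⊥-elim (column-colour v (≤-trans (n≤1+n n) (n≤1+n _)) e)
  colour-direction {right} {down} _ v e = ⊥-elim (column-colour v ≤-refl (sym e))
  colour-direction {up} {down} _ v e = ⊥-elim (column-colour v (n≤1+n n) (sym e))
  colour-direction {left} {down} _ v e = ⊥-elim (column-colour v (≤-trans (n≤1+n n) (n≤1+n _)) (sym e))
  colour-direction {right} {up} _ _ e = ⊥-elim (1+n≢n (sym e))
  colour-direction {up} {right} _ _ e = ⊥-elim (1+n≢n e)
  colour-direction {right} {left} _ _ e = ⊥-elim (2+n≢n (sym e))
  colour-direction {left} {right} _ _ e = ⊥-elim (2+n≢n e)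
  colour-direction {up} {left} _ _ e = ⊥-elim (1+n≢n (sym (suc-injective e)))
  colour-direction {left} {up} _ _ e = ⊥-elim (1+n≢n (suc-injective e))

  separated : ∀ {d d' v w v' w'} → Step d v w → Step d' v' w' →
              colour d v ≡ colour d' v' → Overlap d v d' v' → d ≡ d' × v ≡ v'
  separated {d} {d'} {v} {w} {v'} {w'} v→w v'→w' same intervals-meet with colour-direction {d} {d'} v v' same
  ... | refl = refl , same-source v→w v'→w' same intervals-meet
    where
    same-source : ∀ {d v w v' w'} → Step d v w → Step d v' w' →
                  colour d v ≡ colour d v' → Overlap d v d v' → v ≡ v'
    same-source {v = v} {v' = v'} (down _ _) (down _ _) same (h , h') =
      cell-≡ (≤-antisym (down-rows v v' same h) (down-rows v' v (sym same) h')) same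
    same-source {v = v} {v' = v'} (up _ _) (up _ _) _ (h , h') =
      index-injective v v' (≤-antisym (triple-≤ _ _ h) (triple-≤ _ _ h'))
    same-source {v = v} {v' = v'} (left _ _) (left _ _) _ (h , h') =
      index-injective v v' (≤-antisym (thirds 1 _ _ h) (thirds 1 _ _ h'))
    same-source {v = v} {v' = v'} v→w@(right _ _) v'→w'@(right _ _) _ (h , h') with <-cmp (index v) (index v')
    ... | tri< i<i' _ _ = ⊥-elim (right-disjoint v→w v'→w' i<i' h')
    ... | tri≈ _ i≡i' _ = index-injective v v' i≡i'
    ... | tri> _ _ i>i' = ⊥-elim (right-disjoint v'→w' v→w i>i' h)

  down-nonempty : 1 ≤ n → ∀ i → 3 * i + 2 ≤ 3 * (i + n)
  down-nonempty n≥1 i = ≤-trans (+-monoʳ-≤ (3 * i) (≤-trans (n≤1+n 2) (*-monoʳ-≤ 3 n≥1)))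
                                (≤-reflexive (sym (*-distribˡ-+ 3 i n)))

  attach-inside : 1 ≤ n → ∀ d v → Inside d v (attach v)
  attach-inside n≥1 down v = ≤-refl , down-nonempty n≥1 (index v)
  attach-inside _ up v = m≤m+n _ 2 , ≤-refl
  attach-inside _ right v = ≤-refl , ≤-trans (+-monoʳ-≤ (3 * index v) (s≤s (s≤s z≤n))) (rightEnd-≥ v)
  attach-inside _ left v = +-monoʳ-≤ (3 * index v) (s≤s z≤n) , +-monoʳ-≤ (3 * index v) (s≤s (s≤s z≤n))

  attach-< : ∀ v → attach v < 3 * (n * n)
  attach-< v = ≤-trans (≤-reflexive (next (index v))) (*-monoʳ-≤ 3 (index-< v))
    where
    next : ∀ i → suc (3 * i + 2) ≡ 3 * suc i
    next = solve-∀

  position-right : ∀ {v w} → Step right v w → 3 * index w + 1 ≡ 3 * index v + 4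
  position-right {v} v→w = trans (cong (λ i → 3 * i + 1) (index-right v→w)) (shift (index v))
    where
    shift : ∀ i → 3 * suc i + 1 ≡ 3 * i + 4
    shift = solve-∀

  meeting : 1 ≤ n → ∀ {d v w} → Step d v w →
            Σ ℕ λ q → q < 3 * (n * n) × Inside d v q × Inside (opposite d) w q
  meeting n≥1 {v = v} {w} v→w@(down _ _) =
    3 * index w , ≤-<-trans (m≤m+n _ 2) (attach-< w)
    , (≤-trans (down-nonempty n≥1 (index v)) (≤-reflexive (sym below)) , ≤-reflexive below)
    , (≤-refl , m≤m+n _ 2)
    where
    below : 3 * index w ≡ 3 * (index v + n)
    below = cong (3 *_) (index-down v→w)
  meeting n≥1 {v = v} {w} v→w@(up _ _) =
    3 * index v , ≤-<-trans (m≤m+n _ 2) (attach-< v)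
    , (≤-refl , m≤m+n _ 2)
    , (≤-trans (down-nonempty n≥1 (index w)) (≤-reflexive (sym above)) , ≤-reflexive above)
    where
    above : 3 * index v ≡ 3 * (index w + n)
    above = cong (3 *_) (index-down (reverse-step v→w))
  meeting _ {v = v} {w} v→w@(right _ _) =
    3 * index w + 1 , ≤-<-trans (+-monoʳ-≤ _ (s≤s z≤n)) (attach-< w)
    , ( ≤-trans (+-monoʳ-≤ (3 * index v) (s≤s (s≤s z≤n))) (≤-reflexive (sym next))
      , ≤-trans (≤-reflexive next) (rightEnd-≥ v))
    , (≤-refl , +-monoʳ-≤ _ (s≤s z≤n))
    where
    next : 3 * index w + 1 ≡ 3 * index v + 4
    next = position-right v→w
  meeting _ {v = v} {w} v→w@(left _ _) =
    3 * index v + 1 , ≤-<-trans (+-monoʳ-≤ _ (s≤s z≤n)) (attach-< v)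
    , (≤-refl , +-monoʳ-≤ _ (s≤s z≤n))
    , ( ≤-trans (+-monoʳ-≤ (3 * index w) (s≤s (s≤s z≤n))) (≤-reflexive (sym next))
      , ≤-trans (≤-reflexive next) (rightEnd-≥ w))
    where
    next : 3 * index v + 1 ≡ 3 * index w + 4
    next = position-right (reverse-step v→w)

gridPart-no-cells : ∀ {n} (xs : List (V⁺ n)) → (∀ v → ¬ orig v ∈ xs) → gridPart xs ≡ []
gridPart-no-cells [] _ = refl
gridPart-no-cells (orig v ∷ _) no-cells = ⊥-elim (no-cells v (here refl))
gridPart-no-cells (sub _ _ _ ∷ xs) no-cells = gridPart-no-cells xs (λ v v∈xs → no-cells v (there v∈xs))

module Bags (n : ℕ) where
  open Grid n
  open Schedule n

  half-≡ : ∀ {v v' w w' : Cell n} {p : GridEdge v w} {p' : GridEdge v' w'} →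
           v ≡ v' → w ≡ w' → sub v w p ≡ sub v' w' p'
  half-≡ refl refl = cong (sub _ _) (T-irrelevant _ _)

  _≟ᶜ_ : DecidableEquality (Cell n)
  _≟ᶜ_ = ≡-dec _≟ᶠ_ _≟ᶠ_

  _≟⁺_ : DecidableEquality (V⁺ n)
  orig v ≟⁺ orig v' = map′ (cong orig) (λ { refl → refl }) (v ≟ᶜ v')
  orig _ ≟⁺ sub _ _ _ = no λ ()
  sub _ _ _ ≟⁺ orig _ = no λ ()
  sub v w p ≟⁺ sub v' w' p' with v ≟ᶜ v' | w ≟ᶜ w'
  ... | yes v≡v' | yes w≡w' = yes (half-≡ v≡v' w≡w')
  ... | no v≢v' | _ = no λ { refl → v≢v' refl }
  ... | yes _ | no w≢w' = no λ { refl → w≢w' refl }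

  cells : List (Cell n)
  cells = cartesianProduct (allFin n) (allFin n)

  cell∈ : ∀ v → v ∈ cells
  cell∈ (i , j) = ∈-cartesianProduct⁺ (∈-allFin i) (∈-allFin j)

  halfEdge : Cell n × Cell n → Maybe (V⁺ n)
  halfEdge (v , w) with T? (gridAdj v w)
  ... | yes p = just (sub v w p)
  ... | no _ = nothing

  vertices : List (V⁺ n)
  vertices = map orig cells ++ mapMaybe halfEdge (cartesianProduct cells cells)

  vertices-complete : ∀ x → x ∈ vertices
  vertices-complete (orig v) = ∈-++⁺ˡ (∈-map⁺ orig (cell∈ v))
  vertices-complete (sub v w p) = ∈-++⁺ʳ (map orig cells)
    (Any.mapMaybe⁺ halfEdge _ (Any.map⁺ (Any.map found (∈-cartesianProduct⁺ (cell∈ v) (cell∈ w)))))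
    where
    found : ∀ {a} → (v , w) ≡ a → MaybeAny.Any (sub v w p ≡_) (halfEdge a)
    found refl with T? (gridAdj v w)
    ... | yes _ = MaybeAny.just (half-≡ refl refl)
    ... | no ¬p = ⊥-elim (¬p p)

  open Listing _≟⁺_ vertices vertices-complete

  direction : ∀ v w → GridEdge v w → Direction
  direction v w p = proj₁ (classify v w p)

  direction-step : ∀ v w (p : GridEdge v w) → Step (direction v w p) v w
  direction-step v w p = proj₂ (classify v w p)

  same-half : ∀ {v w w'} (p : GridEdge v w) (p' : GridEdge v w') → direction v w p ≡ direction v w' p' →
              sub v w p ≡ sub v w' p'
  same-half {v} {w} {w'} p p' same =
    half-≡ refl (target-unique (direction-step v w p)
                               (subst (λ d → Step d v w') (sym same) (direction-step v w' p')))

  OnSpine : ℕ → V⁺ n → Set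
  OnSpine q (orig _) = ⊥
  OnSpine q (sub v w p) = Inside (direction v w p) v q

  OnSpine? : ∀ q → Decidable (OnSpine q)
  OnSpine? q (orig _) = no λ ()
  OnSpine? q (sub v w p) = (start (direction v w p) v ≤? q) ×-dec (q ≤? end (direction v w p) v)

  LeavesFrom : Cell n → V⁺ n → Set
  LeavesFrom v (orig _) = ⊥
  LeavesFrom v (sub u _ _) = u ≡ v

  LeavesFrom? : ∀ v → Decidable (LeavesFrom v)
  LeavesFrom? v (orig _) = no λ ()
  LeavesFrom? v (sub u _ _) = u ≟ᶜ v

  spineBag : ℕ → List (V⁺ n)
  spineBag q = listing (OnSpine? q)

  leafBag : Cell n → List (V⁺ n)
  leafBag v = orig v ∷ listing (LeavesFrom? v)

  spineBag-unique : ∀ q → Unique (spineBag q)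
  spineBag-unique q = listing-unique (OnSpine? q)

  leafBag-unique : ∀ v → Unique (leafBag v)
  leafBag-unique v =
    All.tabulate (λ { x∈ refl → listing⁻ (LeavesFrom? v) x∈ }) ∷ listing-unique (LeavesFrom? v)

  leafBag⁻ : ∀ v {x} → x ∈ leafBag v → InStar v x
  leafBag⁻ v (here refl) = inj₁ refl
  leafBag⁻ v {orig _} (there x∈) = ⊥-elim (listing⁻ (LeavesFrom? v) x∈)
  leafBag⁻ v {sub u w p} (there x∈) with listing⁻ (LeavesFrom? v) x∈
  ... | refl = inj₂ (w , p , refl)

  leafBag⁺ : ∀ v {x} → InStar v x → x ∈ leafBag v
  leafBag⁺ v (inj₁ refl) = here refl
  leafBag⁺ v (inj₂ (w , p , refl)) = there (listing⁺ (LeavesFrom? v) refl)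

  spineBag⁻ : ∀ q {x} → x ∈ spineBag q → OnSpine q x
  spineBag⁻ q = listing⁻ (OnSpine? q)

  spineBag⁺ : ∀ q {x} → OnSpine q x → x ∈ spineBag q
  spineBag⁺ q = listing⁺ (OnSpine? q)

  gridPart-spine : ∀ q → gridPart (spineBag q) ≡ []
  gridPart-spine q = gridPart-no-cells (spineBag q) (λ v v∈ → spineBag⁻ q v∈)

  gridPart-leaf : ∀ v → gridPart (leafBag v) ≡ v ∷ []
  gridPart-leaf v =
    cong (v ∷_) (gridPart-no-cells (listing (LeavesFrom? v)) (λ u u∈ → listing⁻ (LeavesFrom? v) u∈))

  colourOf : V⁺ n → ℕ
  colourOf (orig _) = 0
  colourOf (sub v w p) = colour (direction v w p) v

  colour-injective : ∀ q {x y} → OnSpine q x → OnSpine q y → colourOf x ≡ colourOf y → x ≡ y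
  colour-injective q {sub v w p} {sub v' w' p'} (s≤q , q≤e) (s'≤q , q≤e') same
    with separated (direction-step v w p) (direction-step v' w' p') same (≤-trans s≤q q≤e' , ≤-trans s'≤q q≤e)
  ... | d≡d' , refl = same-half p p' d≡d'

  spine-width : ∀ q → length (spineBag q) ≤ n + 3
  spine-width q = subst (length (spineBag q) ≤_) (length-upTo (n + 3))
    (injection-length colourOf (spineBag q) (upTo (n + 3)) (spineBag-unique q)
      (λ x∈ → ∈-upTo⁺ (colour-bound (spineBag⁻ q x∈)))
      (λ x∈ y∈ → colour-injective q (spineBag⁻ q x∈) (spineBag⁻ q y∈)))
    where
    colour-bound : ∀ {x} → OnSpine q x → colourOf x < n + 3
    colour-bound {sub v w p} _ = colour-< (direction v w p) v

  directionOf : V⁺ n → Direction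
  directionOf (orig _) = down
  directionOf (sub v w p) = direction v w p

  directions : List Direction
  directions = down ∷ up ∷ right ∷ left ∷ []

  direction∈ : ∀ d → d ∈ directions
  direction∈ down = here refl
  direction∈ up = there (here refl)
  direction∈ right = there (there (here refl))
  direction∈ left = there (there (there (here refl)))

  -- A cell has at most four half-edges, so a leaf bag has at most
  -- 5 ≤ n + 3 vertices.
  leaf-width : 2 ≤ n → ∀ v → length (leafBag v) ≤ n + 3
  leaf-width n≥2 v = ≤-trans (s≤s star) (+-monoˡ-≤ 3 n≥2)
    where
    same-direction : ∀ {x y} → LeavesFrom v x → LeavesFrom v y → directionOf x ≡ directionOf y → x ≡ y
    same-direction {sub _ _ p} {sub _ _ p'} refl refl same = same-half p p' same
    star : length (listing (LeavesFrom? v)) ≤ 4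
    star = injection-length directionOf (listing (LeavesFrom? v)) directions (listing-unique (LeavesFrom? v))
      (λ _ → direction∈ _)
      (λ x∈ y∈ → same-direction (listing⁻ (LeavesFrom? v) x∈) (listing⁻ (LeavesFrom? v) y∈))

-- For n = m + 2 the width is attained: the spine bag at position 3n holds
-- a half-edge of every colour (the downward ones from the top row, the
-- stretched step right into the corner, the step up from (1,0) and the step
-- left out of the corner).
module Attained (m : ℕ) where
  n : ℕ
  n = suc (suc m)
  open Grid n
  open Schedule n
  open Bags n

  peak : ℕ
  peak = 3 * n

  present : ∀ {d v w} → Step d v w → Inside d v peak → colour d v ∈ map colourOf (spineBag peak)
  present {d} {v} {w} v→w inside =
    subst (_∈ map colourOf (spineBag peak)) (cong (λ d → colour d v) same)
      (∈-map⁺ colourOf (spineBag⁺ peak {sub v w (step-edge v→w)}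
                                   (subst (λ d → Inside d v peak) (sym same) inside)))
    where
    same : direction v w (step-edge v→w) ≡ d
    same = direction-unique (direction-step v w (step-edge v→w)) v→w

  top : ∀ {j} → j < n → Cell n
  top j<n = Fin.zero , fromℕ< j<n

  index-top : ∀ {j} (j<n : j < n) → index (top j<n) ≡ j
  index-top {j} j<n = trans (cong (_+ toℕ (fromℕ< j<n)) (*-zeroʳ n)) (toℕ-fromℕ< j<n)

  m<n : m < n
  m<n = n≤1+n (suc m)

  -- The first cell of the second row has index n, so position 3n is its
  -- first position.
  below : Cell n
  below = Fin.suc Fin.zero , Fin.zero

  index-below : index below ≡ n
  index-below = trans (+-identityʳ (n * 1)) (*-identityʳ n)

  peak-< : peak < 3 * (n * n)
  peak-< = ≤-<-trans (m≤m+n peak 2) (subst (λ i → 3 * i + 2 < 3 * (n * n)) index-below (attach-< below))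

  column : ∀ {c} → c < n → c ∈ map colourOf (spineBag peak)
  column {c} c<n = subst (_∈ _) (toℕ-fromℕ< c<n)
    (present {v = top c<n} {w = Fin.suc Fin.zero , fromℕ< c<n} (down refl refl)
      ( subst (λ i → 3 * i + 2 ≤ peak) (sym (index-top c<n)) (triple-<⁺ c<n)
      , *-monoʳ-≤ 3 (m≤n+m n (index (top c<n)))))

  stretched-right : n ∈ map colourOf (spineBag peak)
  stretched-right = present {v = top m<n} {w = top ≤-refl}
    (right refl (trans (toℕ-fromℕ< ≤-refl) (cong suc (sym (toℕ-fromℕ< m<n)))))
    ( subst (λ i → 3 * i + 2 ≤ peak) (sym (index-top m<n)) (triple-<⁺ m<n)
    , ≤-reflexive (sym (trans (rightEnd-last (top m<n) (cong (2 +_) (toℕ-fromℕ< m<n)))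
                             (trans (cong (λ i → 3 * i + 6) (index-top m<n)) (corner m)))))
    where
    corner : ∀ m → 3 * m + 6 ≡ 3 * suc (suc m)
    corner = solve-∀

  second-row-up : suc n ∈ map colourOf (spineBag peak)
  second-row-up = present {v = below} {w = Fin.zero , Fin.zero} (up refl refl)
    (≤-reflexive (cong (3 *_) index-below) , subst (λ i → peak ≤ 3 * i + 2) (sym index-below) (m≤m+n peak 2))

  corner-left : suc (suc n) ∈ map colourOf (spineBag peak)
  corner-left = present {v = top ≤-refl} {w = top m<n}
    (left refl (trans (toℕ-fromℕ< ≤-refl) (cong suc (sym (toℕ-fromℕ< m<n)))))
    ( subst (λ i → 3 * i + 1 ≤ peak) (sym (index-top ≤-refl)) (≤-trans (m≤m+n _ 2) (≤-reflexive (inner m)))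
    , subst (λ i → peak ≤ 3 * i + 3) (sym (index-top ≤-refl)) (≤-reflexive (outer m)))
    where
    inner : ∀ m → 3 * suc m + 1 + 2 ≡ 3 * suc (suc m)
    inner = solve-∀
    outer : ∀ m → 3 * suc (suc m) ≡ 3 * suc m + 3
    outer = solve-∀

  every-colour : ∀ c → c < n + 3 → c ∈ map colourOf (spineBag peak)
  every-colour c c<n+3 with c <? n | c ≟ n | c ≟ suc n
  ... | yes c<n | _ | _ = column c<n
  ... | no _ | yes refl | _ = stretched-right
  ... | no _ | no _ | yes refl = second-row-up
  ... | no c≮n | no c≢n | no c≢1+n = subst (_∈ _) (sym last-colour) corner-left
    where
    last-colour : c ≡ suc (suc n)
    last-colour = ≤-antisym (≤-pred (subst (c <_) (+-comm n 3) c<n+3))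
      (≤∧≢⇒< (≤∧≢⇒< (≮⇒≥ c≮n) (c≢n ∘ sym)) (c≢1+n ∘ sym))

  full-width : n + 3 ≤ length (spineBag peak)
  full-width = subst₂ _≤_ (length-upTo (n + 3)) (length-map colourOf (spineBag peak))
    (injection-length (λ c → c) (upTo (n + 3)) (map colourOf (spineBag peak)) (Unique.upTo⁺ (n + 3))
      (λ c∈ → every-colour _ (∈-upTo⁻ c∈)) (λ _ _ same → same))

-- The tree: a spine path of 3n² nodes (position q is node q) and one leaf
-- per cell v, hanging from spine position attach v.
module Decomposition (n : ℕ) (n≥1 : 1 ≤ n) where
  open Grid n
  open Schedule n
  open Bags n

  S N : ℕ
  S = 3 * (n * n)
  N = n * n

  Node : Set
  Node = Fin (S + N)

  spine : Fin S → Node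
  spine q = q ↑ˡ N

  leaf : Cell n → Node
  leaf v = S ↑ʳ combine (proj₁ v) (proj₂ v)

  toℕ-spine : ∀ q → toℕ (spine q) ≡ toℕ q
  toℕ-spine q = toℕ-↑ˡ q N

  toℕ-leaf : ∀ v → toℕ (leaf v) ≡ S + index v
  toℕ-leaf (i , j) = trans (toℕ-↑ʳ S (combine i j)) (cong (S +_) (toℕ-combine i j))

  data View : Node → Set where
    spine-node : ∀ q → View (spine q)
    leaf-node : ∀ v → View (leaf v)

  view : ∀ t → View t
  view t with splitAt S t in eq
  ... | inj₁ q = subst View (splitAt⁻¹-↑ˡ eq) (spine-node q)
  ... | inj₂ l = subst View (trans (cong (S ↑ʳ_) (combine-remQuot {n} n l)) (splitAt⁻¹-↑ʳ eq))
                        (leaf-node (remQuot {n} n l))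

  byCases : {A : Set} → (Fin S → A) → (Cell n → A) → Node → A
  byCases f g t = [ f , (λ l → g (remQuot {n} n l)) ]′ (splitAt S t)

  byCases-spine : ∀ {A : Set} (f : Fin S → A) g q → byCases f g (spine q) ≡ f q
  byCases-spine f g q = cong [ f , (λ l → g (remQuot {n} n l)) ]′ (splitAt-↑ˡ S q N)

  byCases-leaf : ∀ {A : Set} f (g : Cell n → A) v → byCases f g (leaf v) ≡ g v
  byCases-leaf f g (i , j) = trans (cong [ f , (λ l → g (remQuot {n} n l)) ]′ (splitAt-↑ʳ S N (combine i j)))
                                   (cong g (remQuot-combine i j))

  spine-≢-leaf : ∀ q v → spine q ≢ leaf v
  spine-≢-leaf q v eq = <⇒≱ (toℕ<n q) (≤-trans (m≤m+n S (index v))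
    (≤-reflexive (trans (sym (toℕ-leaf v)) (trans (cong toℕ (sym eq)) (toℕ-spine q)))))

  previous : Fin S → Fin S
  previous q = fromℕ< (≤-<-trans (m∸n≤m (toℕ q) 1) (toℕ<n q))

  attachNode : Cell n → Fin S
  attachNode v = fromℕ< (attach-< v)

  parent : Node → Node
  parent = byCases (λ q → spine (previous q)) (λ v → spine (attachNode v))

  β : Node → List (V⁺ n)
  β = byCases (λ q → spineBag (toℕ q)) leafBag

  parent-spine : ∀ q → parent (spine q) ≡ spine (previous q)
  parent-spine = byCases-spine (λ q → spine (previous q)) (λ v → spine (attachNode v))

  parent-leaf : ∀ v → parent (leaf v) ≡ spine (attachNode v)
  parent-leaf = byCases-leaf (λ q → spine (previous q)) (λ v → spine (attachNode v))

  toℕ-previous : ∀ q → toℕ (previous q) ≡ toℕ q ∸ 1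
  toℕ-previous q = toℕ-fromℕ< _

  S>0 : 0 < S
  S>0 = ≤-<-trans z≤n (attach-< (fromℕ< n≥1 , fromℕ< n≥1))

  parent-< : ∀ t → 0 < toℕ t → toℕ (parent t) < toℕ t
  parent-< t t>0 with view t
  ... | spine-node q = begin-strict
    toℕ (parent (spine q))   ≡⟨ cong toℕ (parent-spine q) ⟩
    toℕ (spine (previous q)) ≡⟨ trans (toℕ-spine (previous q)) (toℕ-previous q) ⟩
    toℕ q ∸ 1                <⟨ ∸-monoʳ-< (s≤s z≤n) (subst (1 ≤_) (toℕ-spine q) t>0) ⟩
    toℕ q ∸ 0                ≡⟨ sym (toℕ-spine q) ⟩
    toℕ (spine q)            ∎
    where open ≤-Reasoning
  ... | leaf-node v = begin-strict
    toℕ (parent (leaf v))     ≡⟨ cong toℕ (parent-leaf v) ⟩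
    toℕ (spine (attachNode v)) ≡⟨ toℕ-spine (attachNode v) ⟩
    toℕ (attachNode v)         <⟨ toℕ<n (attachNode v) ⟩
    S                          ≤⟨ m≤m+n S (index v) ⟩
    S + index v                ≡⟨ sym (toℕ-leaf v) ⟩
    toℕ (leaf v)               ∎
    where open ≤-Reasoning

  open ParentPointers parent parent-< public

  spine-edge : ∀ q → 0 < toℕ q → Edge (spine q) (spine (previous q))
  spine-edge q q>0 = inj₂ (subst (0 <_) (sym (toℕ-spine q)) q>0 , parent-spine q)

  leaf-edge : ∀ v → Edge (spine (attachNode v)) (leaf v)
  leaf-edge v = inj₁ (subst (0 <_) (sym (toℕ-leaf v)) (≤-trans S>0 (m≤m+n S (index v))) , parent-leaf v)

  -- Every parent is a spine node, so a leaf has no children.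
  leaf-neighbour : ∀ v s → Edge s (leaf v) → s ≡ spine (attachNode v)
  leaf-neighbour v s (inj₁ (_ , parent≡s)) = trans (sym parent≡s) (parent-leaf v)
  leaf-neighbour v s (inj₂ (_ , parent≡leaf)) with view s
  ... | spine-node q = ⊥-elim (spine-≢-leaf (previous q) v (trans (sym (parent-spine q)) parent≡leaf))
  ... | leaf-node u = ⊥-elim (spine-≢-leaf (attachNode u) v (trans (sym (parent-leaf u)) parent≡leaf))

  β-spine : ∀ q → β (spine q) ≡ spineBag (toℕ q)
  β-spine = byCases-spine (λ q → spineBag (toℕ q)) leafBag

  β-leaf : ∀ v → β (leaf v) ≡ leafBag v
  β-leaf = byCases-leaf (λ q → spineBag (toℕ q)) leafBag

  walk-down : ∀ (P : Node → Set) lo .(lo<S : lo < S) k (q : Fin S) → toℕ q ≡ k + lo →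
              (∀ c → lo ≤ toℕ c → toℕ c ≤ toℕ q → P (spine c)) → Walk Edge P (spine q) (spine (fromℕ< lo<S))
  walk-down P lo lo<S zero q q≡lo on =
    subst (λ c → Walk Edge P (spine q) (spine c)) q≡lo′ ([] (on q (≤-reflexive (sym q≡lo)) ≤-refl))
    where
    q≡lo′ : q ≡ fromℕ< lo<S
    q≡lo′ = toℕ-injective (trans q≡lo (sym (toℕ-fromℕ< lo<S)))
  walk-down P lo lo<S (suc k) q q≡ on =
    step (on q lo≤q ≤-refl) (spine-edge q (subst (0 <_) (sym q≡) (s≤s z≤n)))
      (walk-down P lo lo<S k (previous q) (trans (toℕ-previous q) (cong (_∸ 1) q≡))
        (λ c lo≤c c≤prev → on c lo≤c (≤-trans c≤prev prev≤q)))
    where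
    lo≤q : lo ≤ toℕ q
    lo≤q = subst (lo ≤_) (sym q≡) (m≤n+m lo (suc k))
    prev≤q : toℕ (previous q) ≤ toℕ q
    prev≤q = subst (_≤ toℕ q) (sym (toℕ-previous q)) (m∸n≤m (toℕ q) 1)

  interval-walk : ∀ (P : Node → Set) lo hi → (∀ c → lo ≤ toℕ c → toℕ c ≤ hi → P (spine c)) →
                  ∀ a b → lo ≤ toℕ a → toℕ a ≤ hi → lo ≤ toℕ b → toℕ b ≤ hi → Walk Edge P (spine a) (spine b)
  interval-walk P lo hi on a b lo≤a a≤hi lo≤b b≤hi =
    to-lo a lo≤a a≤hi ++ʷ reverseʷ Edge-sym (to-lo b lo≤b b≤hi)
    where
    lo<S : lo < S
    lo<S = ≤-<-trans lo≤a (toℕ<n a)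
    to-lo : ∀ c → lo ≤ toℕ c → toℕ c ≤ hi → Walk Edge P (spine c) (spine (fromℕ< lo<S))
    to-lo c lo≤c c≤hi =
      walk-down P lo lo<S (toℕ c ∸ lo) c (sym (m∸n+n≡m lo≤c)) (λ c' l u → on c' l (≤-trans u c≤hi))

  home : V⁺ n → Cell n
  home (orig v) = v
  home (sub v _ _) = v

  at-home : ∀ x → x ∈ β (leaf (home x))
  at-home (orig v) = subst (orig v ∈_) (sym (β-leaf v)) (here refl)
  at-home (sub v w p) = subst (sub v w p ∈_) (sym (β-leaf v)) (leafBag⁺ v (inj₂ (w , p , refl)))

  -- From a spine bag containing a half-edge, walk along its interval to the
  -- attachment point and then to its leaf.
  spine-to-home : ∀ x q → x ∈ spineBag (toℕ q) → Walk Edge (λ s → x ∈ β s) (spine q) (leaf (home x))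
  spine-to-home (orig v) q x∈ = ⊥-elim (spineBag⁻ (toℕ q) x∈)
  spine-to-home x@(sub v w p) q x∈ =
    snocʷ (interval-walk P (start d v) (end d v) on q (attachNode v) s≤q q≤e s≤a a≤e)
          (leaf-edge v) (at-home x)
    where
    d : Direction
    d = direction v w p
    P : Node → Set
    P s = x ∈ β s
    on : ∀ c → start d v ≤ toℕ c → toℕ c ≤ end d v → P (spine c)
    on c s≤c c≤e = subst (x ∈_) (sym (β-spine c)) (spineBag⁺ (toℕ c) (s≤c , c≤e))
    s≤q : start d v ≤ toℕ q
    s≤q = proj₁ (spineBag⁻ (toℕ q) x∈)
    q≤e : toℕ q ≤ end d v
    q≤e = proj₂ (spineBag⁻ (toℕ q) x∈)
    s≤a : start d v ≤ toℕ (attachNode v)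
    s≤a = subst (start d v ≤_) (sym (toℕ-fromℕ< (attach-< v))) (proj₁ (attach-inside n≥1 d v))
    a≤e : toℕ (attachNode v) ≤ end d v
    a≤e = subst (_≤ end d v) (sym (toℕ-fromℕ< (attach-< v))) (proj₂ (attach-inside n≥1 d v))

  to-home : ∀ x t → x ∈ β t → Walk Edge (λ s → x ∈ β s) t (leaf (home x))
  to-home x t x∈ with view t
  ... | spine-node q = spine-to-home x q (subst (x ∈_) (β-spine q) x∈)
  ... | leaf-node u with leafBag⁻ u (subst (x ∈_) (β-leaf u) x∈)
  ...   | inj₁ refl = [] x∈
  ...   | inj₂ (_ , _ , refl) = [] x∈

  onSpine-β : ∀ {x} q (q<S : q < S) → OnSpine q x → x ∈ β (spine (fromℕ< q<S))
  onSpine-β {x} q q<S on = subst (x ∈_) (sym (β-spine _))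
    (subst (λ k → x ∈ spineBag k) (sym (toℕ-fromℕ< q<S)) (spineBag⁺ q on))

  -- An edge v–(v,w) lies in the leaf bag of v; an edge (v,w)–(w,v) in the
  -- spine bag where the intervals of the two halves meet.
  edge-covered : ∀ x y → E⁺ x y → ∃ λ t → x ∈ β t × y ∈ β t
  edge-covered _ _ (e-end v w p) = leaf v , at-home (orig v) , at-home (sub v w p)
  edge-covered _ _ (e-mid v w p p') with meeting n≥1 (direction-step v w p)
  ... | q , q<S , inside , inside' =
    spine (fromℕ< q<S) , onSpine-β q q<S inside
    , onSpine-β q q<S (subst (λ d → Inside d w q) (sym reversed) inside')
    where
    reversed : direction w v p' ≡ opposite (direction v w p)
    reversed = direction-unique (direction-step w v p') (reverse-step (direction-step v w p))

  bag-unique : ∀ t → Unique (β t)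
  bag-unique t with view t
  ... | spine-node q = subst Unique (sym (β-spine q)) (spineBag-unique (toℕ q))
  ... | leaf-node v = subst Unique (sym (β-leaf v)) (leafBag-unique v)

  decomposition : TreeDecomposition (V⁺ n) E⁺
  decomposition = record
    { size = S + N
    ; ET = Edge
    ; isTree = isTree (≤-trans S>0 (m≤m+n S N))
    ; β = β
    ; bagUnique = bag-unique
    ; vertexCovered = λ x → leaf (home x) , at-home x
    ; vertexConnected = λ x t t' x∈t x∈t' → to-home x t x∈t ++ʷ reverseʷ Edge-sym (to-home x t' x∈t')
    ; edgeCovered = edge-covered
    }

  bag-width : 2 ≤ n → ∀ t → length (β t) ≤ n + 3
  bag-width n≥2 t with view t
  ... | spine-node q = subst (λ b → length b ≤ n + 3) (sym (β-spine q)) (spine-width (toℕ q))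
  ... | leaf-node v = subst (λ b → length b ≤ n + 3) (sym (β-leaf v)) (leaf-width n≥2 v)

  gridPart-β : ∀ t → gridPart (β t) ≡ [] ⊎ Σ (Cell n) λ v → t ≡ leaf v × gridPart (β t) ≡ v ∷ []
  gridPart-β t with view t
  ... | spine-node q = inj₁ (trans (cong gridPart (β-spine q)) (gridPart-spine (toℕ q)))
  ... | leaf-node v = inj₂ (v , refl , trans (cong gridPart (β-leaf v)) (gridPart-leaf v))

  gridPart-≤1 : ∀ t → length (gridPart (β t)) ≤ 1
  gridPart-≤1 t with gridPart-β t
  ... | inj₁ empty = subst (λ g → length g ≤ 1) (sym empty) z≤n
  ... | inj₂ (_ , _ , single) = subst (λ g → length g ≤ 1) (sym single) ≤-refl

  grid-vertex-at-leaf : ∀ t → length (gridPart (β t)) ≡ 1 → Σ (Cell n) λ v → t ≡ leaf v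
  grid-vertex-at-leaf t one with gridPart-β t
  ... | inj₁ empty = ⊥-elim (0≢1+n (trans (sym (cong length empty)) one))
  ... | inj₂ (v , t≡leaf , _) = v , t≡leaf

  leaf-star : ∀ v → (∀ x → (x ∈ β (leaf v)) ⇔ InStar v x) × IsLeaf Edge (leaf v)
                    × (∀ s → Edge s (leaf v) → gridPart (β s) ≡ [])
  leaf-star v = (λ x → mk⇔ (λ x∈ → leafBag⁻ v (subst (x ∈_) (β-leaf v) x∈))
                           (λ star → subst (x ∈_) (sym (β-leaf v)) (leafBag⁺ v star)))
              , (spine (attachNode v) , leaf-edge v , leaf-neighbour v)
              , λ s s~leaf → trans (cong gridPart (trans (cong β (leaf-neighbour v s s~leaf)) (β-spine _)))
                                   (gridPart-spine _)

  star-condition : ∀ t → length (gridPart (β t)) ≡ 1 →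
    Σ (Cell n) λ v → (∀ x → (x ∈ β t) ⇔ InStar v x) × IsLeaf Edge t
                     × (∀ s → Edge s t → gridPart (β s) ≡ [])
  star-condition t one with grid-vertex-at-leaf t one
  ... | v , refl = v , leaf-star v

module Width (m : ℕ) where
  open Decomposition (suc (suc m)) (s≤s z≤n)
  open Bags (suc (suc m))
  open Attained m

  has-width : HasWidth decomposition (n + 2)
  has-width = (λ t → subst (length (β t) ≤_) (sym (+-assoc n 2 1)) (bag-width (s≤s (s≤s z≤n)) t))
            , spine (fromℕ< peak-<) , trans peak-bag (sym (+-assoc n 2 1))
    where
    peak-bag : length (β (spine (fromℕ< peak-<))) ≡ n + 3
    peak-bag = trans (cong length (trans (β-spine _) (cong spineBag (toℕ-fromℕ< peak-<))))
                     (≤-antisym (spine-width peak) full-width)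

mainTheorem19 : ∀ (n : ℕ) → 2 ≤ n →
    Σ (TreeDecomposition (V⁺ n) E⁺) λ D →
      let open TreeDecomposition D in
      HasWidth D (n + 2)
      × (∀ t → length (gridPart (β t)) ≤ 1)
      × (∀ t → length (gridPart (β t)) ≡ 1 →
           Σ (Cell n) λ v →
             (∀ x → (x ∈ β t) ⇔ InStar v x)
             × IsLeaf ET t
             × (∀ s → ET s t → gridPart (β s) ≡ []))
mainTheorem19 (suc zero) (s≤s ())
mainTheorem19 (suc (suc m)) _ = decomposition , has-width , gridPart-≤1 , star-condition
  where
  open Decomposition (suc (suc m)) (s≤s z≤n)
  open Width m
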